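{- For all $a,b,c,d \in \mathbb{N}\cup\{\emptyset\}$ and all $n\ge 0$, $Q_{n,132}^{(a,b,c,d)}(x) = Q_{n,132}^{(a,d,c,b)}(x)$.
   Context: $\mathbb{N}=\{0,1,2,\dots\}$. For a permutation $\sigma=\sigma_1\cdots\sigma_n\in S_n$ (one-line notation) and a position $i$, let $I=\#\{j>i:\sigma_j>\sigma_i\}$, $II=\#\{j<i:\sigma_j>\sigma_i\}$, $III=\#\{j<i:\sigma_j<\sigma_i\}$, $IV=\#\{j>i:\sigma_j<\sigma_i\}$. For $a,b,c,d\in\mathbb{N}\cup\{\emptyset\}$, $\sigma_i$ matches the quadrant marked mesh pattern $MMP(a,b,c,d)$ if $I\ge a$, $II\ge b$, $III\ge c$, $IV\ge d$, where a coordinate equal to $\emptyset$ instead requires the corresponding count to be $0$. $\mathrm{mmp}^{(a,b,c,d)}(\sigma)$ is the number of $i$ such that $\sigma_i$ matches $MMP(a,b,c,d)$. $S_n(132)$ is the set of $\sigma\in S_n$ avoiding the pattern 132 (there are no $i<j<k$ with $\sigma_i<\sigma_k<\sigma_j$). $Q_{n,132}^{(a,b,c,d)}(x)=\sum_{\sigma\in S_n(132)} x^{\mathrm{mmp}^{(a,b,c,d)}(\sigma)}$. -}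

module Defs where

open import Data.Nat using (ℕ; zero; suc; _<ᵇ_; _≡ᵇ_; _+_)
open import Data.Bool using (Bool; true; false; _∧_; _∨_; not; if_then_else_)
open import Data.List using (List; []; _∷_; length; filter; map; concatMap; upTo; take; drop)
open import Data.Maybe using (Maybe; just; nothing)
open import Relation.Nullary.Decidable using (Dec; yes; no)
open import Data.Bool.Properties using () renaming (_≟_ to _≟ᵇ_)
open import Relation.Binary.PropositionalEquality using (_≡_)
open import Data.Nat.Properties using (_≟_)

orL : List Bool → Bool
orL []       = false
orL (b ∷ bs) = b ∨ orL bs

countB : {A : Set} → (A → Bool) → List A → ℕ
countB p []       = 0
countB p (x ∷ xs) = if p x then suc (countB p xs) else countB p xs

-- a coordinate of a quadrant marked mesh pattern: just k  means "≥ k",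
-- nothing  means ∅, i.e. "= 0"
Coord : Set
Coord = Maybe ℕ

_≤ᵇ'_ : ℕ → ℕ → Bool
m ≤ᵇ' n = not (n <ᵇ m)

sat : Coord → ℕ → Bool
sat (just k) m = k ≤ᵇ' m
sat nothing  m = m ≡ᵇ 0

-- entry at position i (0-based); default 0 outside range (never used out of range)
at : List ℕ → ℕ → ℕ
at []       _       = 0
at (x ∷ xs) zero    = x
at (x ∷ xs) (suc i) = at xs i

words : ℕ → ℕ → List (List ℕ)
words m zero    = [] ∷ []
words m (suc n) = concatMap (λ x → map (x ∷_) (words m n)) (upTo m)

distinct : List ℕ → Bool
distinct []       = true
distinct (x ∷ xs) = not (orL (map (λ y → x ≡ᵇ y) xs)) ∧ distinct xs

-- S_n : permutations of {0,…,n-1} in one-line notation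
-- (values shifted by one from {1,…,n}; irrelevant for patterns/statistics)
Sn : ℕ → List (List ℕ)
Sn n = filter (λ w → distinct w ≟ᵇ true) (words n n)

contains132 : List ℕ → Bool
contains132 σ =
  orL (map (λ i → orL (map (λ j → orL (map (λ k →
        (i <ᵇ j) ∧ (j <ᵇ k) ∧ (at σ i <ᵇ at σ k) ∧ (at σ k <ᵇ at σ j))
      (upTo (length σ)))) (upTo (length σ)))) (upTo (length σ)))

Sn132 : ℕ → List (List ℕ)
Sn132 n = filter (λ σ → contains132 σ ≟ᵇ false) (Sn n)

matches : Coord → Coord → Coord → Coord → List ℕ → ℕ → Bool
matches a b c d σ i =
  let v      = at σ i
      before = take i σ
      after  = drop (suc i) σ
      I      = countB (λ y → (v <ᵇ y)) after
      II     = countB (λ y → (v <ᵇ y)) before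
      III    = countB (λ y → (y <ᵇ v)) before
      IV     = countB (λ y → (y <ᵇ v)) after
  in sat a I ∧ sat b II ∧ sat c III ∧ sat d IV

mmp : Coord → Coord → Coord → Coord → List ℕ → ℕ
mmp a b c d σ = countB (λ i → matches a b c d σ i) (upTo (length σ))

-- coefficient of x^k in Q_{n,132}^{(a,b,c,d)}(x)
Qcoeff : ℕ → Coord → Coord → Coord → Coord → ℕ → ℕ
Qcoeff n a b c d k = countB (λ σ → mmp a b c d σ ≡ᵇ k) (Sn132 n)

-- Passing from σ to its inverse τ = σ⁻¹ reflects the permutation
-- diagram in the diagonal: the point (i, σᵢ) goes to (σᵢ, i).  The reflection
-- fixes quadrants I (north-east) and III (south-west) and exchanges II
-- (north-west) with IV (south-east).  Hence σᵢ matches MMP(a,b,c,d) iff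
-- τ_{σᵢ} matches MMP(a,d,c,b), so mmp^{(a,b,c,d)}(σ) = mmp^{(a,d,c,b)}(τ).
-- Since 132⁻¹ = 132, inversion is an involution of S_n(132), and counting
-- over S_n(132) is invariant under it.
module Submission where

open import Defs
open import Data.Bool using (Bool; true; false; _∧_; _∨_; not; if_then_else_; T)
open import Data.Bool.Properties using (∧-comm; ∧-zeroʳ; T-≡; T-∧) renaming (_≟_ to _≟ᵇ_)
open import Data.Empty using (⊥; ⊥-elim)
open import Data.Fin using (Fin; toℕ; fromℕ<; punchOut)
open import Data.Fin.Properties using (toℕ-injective; fromℕ<-injective; punchOut-injective; toℕ<n; <⇒notInjective)
open import Data.List using (List; []; _∷_; length; filter; map; concatMap; upTo; take; drop; applyUpTo)
open import Data.List.Properties using (map-upTo; length-applyUpTo; ∷-injectiveʳ)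
open import Data.List.Membership.Propositional using (_∈_; find)
open import Data.List.Membership.Propositional.Properties using (∈-map⁺; ∈-map⁻; ∈-upTo⁺; ∈-upTo⁻; ∈-concatMap⁺; ∈-concatMap⁻; ∈-filter⁺; ∈-filter⁻)
open import Data.List.Membership.Propositional.Properties.WithK using (unique∧set⇒bag)
open import Data.List.Relation.Binary.BagAndSetEquality using (∼bag⇒↭)
open import Data.List.Relation.Binary.Permutation.Propositional as ↭ using (_↭_)
open import Data.List.Relation.Unary.All using (All; []; _∷_)
import Data.List.Relation.Unary.All as All
open import Data.List.Relation.Unary.Any using (here; there)
import Data.List.Relation.Unary.Any as Any
open import Data.List.Relation.Unary.AllPairs using ([]; _∷_)
open import Data.List.Relation.Unary.Unique.Propositional using (Unique)
open import Data.List.Relation.Unary.Unique.Propositional.Properties using (upTo⁺; ++⁺; map⁺; filter⁺; applyUpTo⁺₁)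
open import Data.Nat using (ℕ; zero; suc; _<ᵇ_; _≡ᵇ_; _<_; z≤n; s≤s)
open import Data.Nat.Properties using (_≟_; <ᵇ⇒<; <⇒<ᵇ; ≡ᵇ⇒≡; ≡⇒≡ᵇ; suc-injective; <-trans; <⇒≢; n<1+n)
open import Data.List.Membership.DecPropositional _≟_ using (_∈?_)
open import Data.Product using (_×_; _,_; proj₁; proj₂)
open import Function using (_∘_)
open import Function.Bundles using (Equivalence; mk⇔)
open import Relation.Binary.PropositionalEquality using (_≡_; _≢_; refl; sym; trans; cong; cong₂; subst; subst₂; module ≡-Reasoning)
open import Relation.Nullary using (yes; no)

-- (1) Counting

-- countB p (x ∷ xs) unfolds to  addIf (p x) (countB p xs).
addIf : Bool → ℕ → ℕ
addIf b m = if b then suc m else m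

countB-map : {A B : Set} (p : B → Bool) (f : A → B) (xs : List A) →
  countB p (map f xs) ≡ countB (p ∘ f) xs
countB-map p f []       = refl
countB-map p f (x ∷ xs) = cong (addIf (p (f x))) (countB-map p f xs)

countB-↭ : {A : Set} (p : A → Bool) {xs ys : List A} → xs ↭ ys → countB p xs ≡ countB p ys
countB-↭ p ↭.refl          = refl
countB-↭ p (↭.prep x xs↭ys) = cong (addIf (p x)) (countB-↭ p xs↭ys)
countB-↭ p (↭.swap x y xs↭ys) with p x | p y
... | true  | true  = cong (suc ∘ suc) (countB-↭ p xs↭ys)
... | true  | false = cong suc (countB-↭ p xs↭ys)
... | false | true  = cong suc (countB-↭ p xs↭ys)
... | false | false = countB-↭ p xs↭ys
countB-↭ p (↭.trans xs↭ys ys↭zs) = trans (countB-↭ p xs↭ys) (countB-↭ p ys↭zs)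

countB-cong : {A : Set} {p q : A → Bool} (xs : List A) →
  (∀ {x} → x ∈ xs → p x ≡ q x) → countB p xs ≡ countB q xs
countB-cong [] p≗q = refl
countB-cong {q = q} (x ∷ xs) p≗q rewrite p≗q (here refl) =
  cong (addIf (q x)) (countB-cong xs (p≗q ∘ there))

-- A map that is injective on the members of a duplicate-free list yields a
-- duplicate-free list (the library version asks for global injectivity).
unique-map : {A B : Set} (f : A → B) (xs : List A) → Unique xs →
  (∀ {x y} → x ∈ xs → y ∈ xs → f x ≡ f y → x ≡ y) → Unique (map f xs)
unique-map f []       []       inj = []
unique-map f (x ∷ xs) (x∉ ∷ u) inj =
  fresh xs x∉ (inj (here refl) ∘ there) ∷ unique-map f xs u (λ m m′ → inj (there m) (there m′))
  where
  fresh : ∀ ys → All (x ≢_) ys → (∀ {y} → y ∈ ys → f x ≡ f y → x ≡ y) → All (f x ≢_) (map f ys)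
  fresh []       []         _   = []
  fresh (y ∷ ys) (x≢y ∷ ne) inj′ = (x≢y ∘ inj′ (here refl)) ∷ fresh ys ne (inj′ ∘ there)

countB-bijection : {A : Set} (p : A → Bool) (L : List A) → Unique L → (f g : A → A) →
  (∀ {x} → x ∈ L → f x ∈ L) → (∀ {x} → x ∈ L → g x ∈ L) →
  (∀ {x} → x ∈ L → g (f x) ≡ x) → (∀ {x} → x ∈ L → f (g x) ≡ x) →
  countB (p ∘ f) L ≡ countB p L
countB-bijection p L u f g f∈ g∈ gf fg =
  trans (sym (countB-map p f L)) (countB-↭ p fL↭L)
  where
  inj : ∀ {x y} → x ∈ L → y ∈ L → f x ≡ f y → x ≡ y
  inj x∈ y∈ e = trans (sym (gf x∈)) (trans (cong g e) (gf y∈))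
  to : ∀ {x} → x ∈ map f L → x ∈ L
  to m with _ , y∈ , refl ← ∈-map⁻ f m = f∈ y∈
  from : ∀ {x} → x ∈ L → x ∈ map f L
  from x∈ = subst (_∈ map f L) (fg x∈) (∈-map⁺ f (g∈ x∈))
  fL↭L : map f L ↭ L
  fL↭L = ∼bag⇒↭ (unique∧set⇒bag (unique-map f L u inj) u (mk⇔ to from))

count< : (ℕ → Bool) → ℕ → ℕ
count< p n = countB p (upTo n)

count<-reindex : (p : ℕ → Bool) (n : ℕ) (f g : ℕ → ℕ) →
  (∀ {i} → i < n → f i < n) → (∀ {i} → i < n → g i < n) →
  (∀ {i} → i < n → g (f i) ≡ i) → (∀ {i} → i < n → f (g i) ≡ i) →
  count< (p ∘ f) n ≡ count< p n
count<-reindex p n f g f< g< gf fg = countB-bijection p (upTo n) (upTo⁺ n) f g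
  (∈-upTo⁺ ∘ f< ∘ ∈-upTo⁻) (∈-upTo⁺ ∘ g< ∘ ∈-upTo⁻) (gf ∘ ∈-upTo⁻) (fg ∘ ∈-upTo⁻)

count<-suc : (p : ℕ → Bool) (n : ℕ) → count< p (suc n) ≡ addIf (p 0) (count< (p ∘ suc) n)
count<-suc p n = cong (addIf (p 0))
  (trans (cong (countB p) (sym (map-upTo suc n))) (countB-map p suc (upTo n)))

count<-cong : {p q : ℕ → Bool} (n : ℕ) → (∀ {i} → i < n → p i ≡ q i) → count< p n ≡ count< q n
count<-cong n p≗q = countB-cong (upTo n) (p≗q ∘ ∈-upTo⁻)

count<-false : (n : ℕ) → count< (λ _ → false) n ≡ 0
count<-false zero    = refl
count<-false (suc n) = trans (count<-suc (λ _ → false) n) (count<-false n)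

-- (2) Lists indexed by position

at-∈ : (xs : List ℕ) {i : ℕ} → i < length xs → at xs i ∈ xs
at-∈ (x ∷ xs) {zero}  _         = here refl
at-∈ (x ∷ xs) {suc i} (s≤s i<) = there (at-∈ xs i<)

All-at : {P : ℕ → Set} (xs : List ℕ) → All P xs → ∀ {i} → i < length xs → P (at xs i)
All-at xs all i< = All.lookup all (at-∈ xs i<)

at-All : {P : ℕ → Set} (xs : List ℕ) → (∀ {i} → i < length xs → P (at xs i)) → All P xs
at-All []       h = []
at-All (x ∷ xs) h = h (s≤s z≤n) ∷ at-All xs (h ∘ s≤s)

at-applyUpTo : (f : ℕ → ℕ) (n : ℕ) {i : ℕ} → i < n → at (applyUpTo f n) i ≡ f i
at-applyUpTo f (suc n) {zero}  _         = refl
at-applyUpTo f (suc n) {suc i} (s≤s i<) = at-applyUpTo (f ∘ suc) n i<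

at-ext : (xs ys : List ℕ) → length xs ≡ length ys →
  (∀ {i} → i < length xs → at xs i ≡ at ys i) → xs ≡ ys
at-ext []       []       _   _  = refl
at-ext (x ∷ xs) (y ∷ ys) len eq =
  cong₂ _∷_ (eq (s≤s z≤n)) (at-ext xs ys (suc-injective len) (eq ∘ s≤s))

countB-positions : (q : ℕ → Bool) (xs : List ℕ) → countB q xs ≡ count< (q ∘ at xs) (length xs)
countB-positions q []       = refl
countB-positions q (x ∷ xs) =
  trans (cong (addIf (q x)) (countB-positions q xs)) (sym (count<-suc (q ∘ at (x ∷ xs)) (length xs)))

countB-take : (q : ℕ → Bool) (xs : List ℕ) (i : ℕ) →
  countB q (take i xs) ≡ count< (λ j → (j <ᵇ i) ∧ q (at xs j)) (length xs)
countB-take q []       zero    = refl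
countB-take q []       (suc i) = refl
countB-take q (x ∷ xs) zero    =
  sym (trans (count<-suc (λ j → (j <ᵇ 0) ∧ q (at (x ∷ xs) j)) (length xs)) (count<-false (length xs)))
countB-take q (x ∷ xs) (suc i) =
  trans (cong (addIf (q x)) (countB-take q xs i))
        (sym (count<-suc (λ j → (j <ᵇ suc i) ∧ q (at (x ∷ xs) j)) (length xs)))

countB-drop : (q : ℕ → Bool) (xs : List ℕ) (i : ℕ) →
  countB q (drop (suc i) xs) ≡ count< (λ j → (i <ᵇ j) ∧ q (at xs j)) (length xs)
countB-drop q []       i       = refl
countB-drop q (x ∷ xs) zero    =
  trans (countB-positions q xs) (sym (count<-suc (λ j → (0 <ᵇ j) ∧ q (at (x ∷ xs) j)) (length xs)))
countB-drop q (x ∷ xs) (suc i) =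
  trans (countB-drop q xs i) (sym (count<-suc (λ j → (suc i <ᵇ j) ∧ q (at (x ∷ xs) j)) (length xs)))

≡ᵇ-refl : (n : ℕ) → (n ≡ᵇ n) ≡ true
≡ᵇ-refl n = Equivalence.to T-≡ (≡⇒≡ᵇ n n refl)

indexOf : List ℕ → ℕ → ℕ
indexOf []       v = 0
indexOf (x ∷ xs) v = if x ≡ᵇ v then 0 else suc (indexOf xs v)

at-indexOf : (xs : List ℕ) {v : ℕ} → v ∈ xs → at xs (indexOf xs v) ≡ v × indexOf xs v < length xs
at-indexOf (x ∷ xs) {v} v∈ with x ≡ᵇ v in x≡ᵇv
... | true = ≡ᵇ⇒≡ x v (Equivalence.from T-≡ x≡ᵇv) , s≤s z≤n
at-indexOf (x ∷ xs) (here refl) | false with () ← trans (sym x≡ᵇv) (≡ᵇ-refl x)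
at-indexOf (x ∷ xs) (there v∈)  | false =
  let (found , bound) = at-indexOf xs v∈ in found , s≤s bound

indexOf-at : (xs : List ℕ) → Unique xs → {i : ℕ} → i < length xs → indexOf xs (at xs i) ≡ i
indexOf-at (x ∷ xs) u {zero} _ rewrite ≡ᵇ-refl x = refl
indexOf-at (x ∷ xs) (x∉ ∷ u) {suc i} (s≤s i<) with x ≡ᵇ at xs i in x≡ᵇxᵢ
... | true  = ⊥-elim (All.lookup x∉ (at-∈ xs i<) (≡ᵇ⇒≡ _ _ (Equivalence.from T-≡ x≡ᵇxᵢ)))
... | false = cong suc (indexOf-at xs u i<)

-- The quadrant counts of the entry at position i, as in the definition of
-- 'matches': I = north-east, II = north-west, III = south-west, IV = south-east.
NE NW SW SE : List ℕ → ℕ → ℕ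
NE σ i = countB (at σ i <ᵇ_) (drop (suc i) σ)
NW σ i = countB (at σ i <ᵇ_) (take i σ)
SW σ i = countB (_<ᵇ at σ i) (take i σ)
SE σ i = countB (_<ᵇ at σ i) (drop (suc i) σ)

-- (3) Decoding the Boolean search predicates

∨-false : ∀ a b → a ∨ b ≡ false → a ≡ false × b ≡ false
∨-false false b b≡f = refl , b≡f

orL-false⇒ : {A : Set} (p : A → Bool) (xs : List A) →
  orL (map p xs) ≡ false → ∀ {y} → y ∈ xs → p y ≡ false
orL-false⇒ p (x ∷ xs) none (here refl) = proj₁ (∨-false (p x) _ none)
orL-false⇒ p (x ∷ xs) none (there y∈)  = orL-false⇒ p xs (proj₂ (∨-false (p x) _ none)) y∈

orL-false⇐ : {A : Set} (p : A → Bool) (xs : List A) →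
  (∀ {y} → y ∈ xs → p y ≡ false) → orL (map p xs) ≡ false
orL-false⇐ p []       h = refl
orL-false⇐ p (x ∷ xs) h rewrite h (here refl) = orL-false⇐ p xs (h ∘ there)

distinct⇒Unique : (xs : List ℕ) → distinct xs ≡ true → Unique xs
distinct⇒Unique []       _ = []
distinct⇒Unique (x ∷ xs) _ with orL (map (x ≡ᵇ_) xs) in fresh | distinct xs in rest
distinct⇒Unique (x ∷ xs) refl | false | true =
  All.tabulate x≢ ∷ distinct⇒Unique xs rest
  where
  x≢ : ∀ {y} → y ∈ xs → x ≢ y
  x≢ y∈ refl with () ← trans (sym (orL-false⇒ (x ≡ᵇ_) xs fresh y∈)) (≡ᵇ-refl x)

Unique⇒distinct : (xs : List ℕ) → Unique xs → distinct xs ≡ true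
Unique⇒distinct []       _        = refl
Unique⇒distinct (x ∷ xs) (x∉ ∷ u) =
  cong₂ (λ dup rest → not dup ∧ rest) (orL-false⇐ (x ≡ᵇ_) xs x≢ᵇ) (Unique⇒distinct xs u)
  where
  x≢ᵇ : ∀ {y} → y ∈ xs → (x ≡ᵇ y) ≡ false
  x≢ᵇ {y} y∈ with x ≡ᵇ y in x≡ᵇy
  ... | false = refl
  ... | true  = ⊥-elim (All.lookup x∉ y∈ (≡ᵇ⇒≡ x y (Equivalence.from T-≡ x≡ᵇy)))

∈-words⁻ : (m n : ℕ) {w : List ℕ} → w ∈ words m n → length w ≡ n × All (_< m) w
∈-words⁻ m zero    (here refl) = refl , []
∈-words⁻ m (suc n) w∈
  with _ , x∈ , w∈′ ← find (∈-concatMap⁻ (λ x → map (x ∷_) (words m n)) {xs = upTo m} w∈)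
  with _ , v∈ , refl ← ∈-map⁻ _ w∈′
  with len , bounded ← ∈-words⁻ m n v∈
  = cong suc len , ∈-upTo⁻ x∈ ∷ bounded

∈-words⁺ : (m n : ℕ) {w : List ℕ} → length w ≡ n → All (_< m) w → w ∈ words m n
∈-words⁺ m zero    {[]}    refl []              = here refl
∈-words⁺ m (suc n) {x ∷ w} len  (x<m ∷ bounded) =
  ∈-concatMap⁺ (λ y → map (y ∷_) (words m n)) {xs = upTo m}
    (Any.map (λ { refl → ∈-map⁺ (x ∷_) (∈-words⁺ m n (suc-injective len) bounded) }) (∈-upTo⁺ x<m))

unique-words : (m n : ℕ) → Unique (words m n)
unique-words m zero    = [] ∷ []
unique-words m (suc n) = prefix-all (upTo m) (upTo⁺ m)
  where
  W = words m n
  prefix-all : (xs : List ℕ) → Unique xs → Unique (concatMap (λ x → map (x ∷_) W) xs)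
  prefix-all []       _        = []
  prefix-all (x ∷ xs) (x∉ ∷ u) =
    ++⁺ (map⁺ ∷-injectiveʳ (unique-words m n)) (prefix-all xs u) disjoint
    where
    disjoint : ∀ {v} → v ∈ map (x ∷_) W × v ∈ concatMap (λ x → map (x ∷_) W) xs → ⊥
    disjoint (v∈ , v∈′) with _ , _ , refl ← ∈-map⁻ (x ∷_) v∈
      with _ , y∈ , v∈″ ← find (∈-concatMap⁻ (λ x → map (x ∷_) W) {xs = xs} v∈′)
      with _ , _ , refl ← ∈-map⁻ _ v∈″
      = All.lookup x∉ y∈ refl

Avoids132 : List ℕ → Set
Avoids132 σ = ∀ {i j k} → i < j → j < k → k < length σ → at σ i < at σ k → at σ k < at σ j → ⊥

occurrence132 : List ℕ → ℕ → ℕ → ℕ → Bool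
occurrence132 σ i j k = (i <ᵇ j) ∧ (j <ᵇ k) ∧ (at σ i <ᵇ at σ k) ∧ (at σ k <ᵇ at σ j)

occurrence132⇒ : (σ : List ℕ) (i j k : ℕ) →
  T (occurrence132 σ i j k) → i < j × j < k × at σ i < at σ k × at σ k < at σ j
occurrence132⇒ σ i j k occ
  with t₁ , occ₁ ← Equivalence.to T-∧ occ
  with t₂ , occ₂ ← Equivalence.to T-∧ occ₁
  with t₃ , t₄ ← Equivalence.to T-∧ occ₂
  = <ᵇ⇒< _ _ t₁ , <ᵇ⇒< _ _ t₂ , <ᵇ⇒< _ _ t₃ , <ᵇ⇒< _ _ t₄

occurrence132⇐ : (σ : List ℕ) {i j k : ℕ} →
  i < j → j < k → at σ i < at σ k → at σ k < at σ j → T (occurrence132 σ i j k)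
occurrence132⇐ σ i<j j<k σi<σk σk<σj = Equivalence.from T-∧ (<⇒<ᵇ i<j ,
  Equivalence.from T-∧ (<⇒<ᵇ j<k , Equivalence.from T-∧ (<⇒<ᵇ σi<σk , <⇒<ᵇ σk<σj)))

contains132-false⇒ : (σ : List ℕ) → contains132 σ ≡ false → Avoids132 σ
contains132-false⇒ σ none {i} {j} {k} i<j j<k k<n σi<σk σk<σj =
  subst T excluded (occurrence132⇐ σ i<j j<k σi<σk σk<σj)
  where
  U = upTo (length σ)
  j<n = <-trans j<k k<n
  i<n = <-trans i<j j<n
  excluded : occurrence132 σ i j k ≡ false
  excluded = orL-false⇒ _ U (orL-false⇒ _ U (orL-false⇒ _ U none (∈-upTo⁺ i<n)) (∈-upTo⁺ j<n)) (∈-upTo⁺ k<n)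

contains132-false⇐ : (σ : List ℕ) → Avoids132 σ → contains132 σ ≡ false
contains132-false⇐ σ avoid =
  orL-false⇐ _ U (λ {i} _ → orL-false⇐ _ U (λ {j} _ → orL-false⇐ _ U (λ k∈ → no-occurrence {i} {j} (∈-upTo⁻ k∈))))
  where
  U = upTo (length σ)
  no-occurrence : ∀ {i j k} → k < length σ → occurrence132 σ i j k ≡ false
  no-occurrence {i} {j} {k} k<n with occurrence132 σ i j k in occ
  ... | false = refl
  ... | true with i<j , j<k , σi<σk , σk<σj ← occurrence132⇒ σ i j k (Equivalence.from T-≡ occ)
    = ⊥-elim (avoid i<j j<k k<n σi<σk σk<σj)

-- (4) Permutations as lists, and their inverses

record IsPerm (σ : List ℕ) : Set where
  field
    unique  : Unique σ
    bounded : All (_< length σ) σ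

-- Pigeonhole: a duplicate-free list of n entries below n contains every v < n.
IsPerm⇒∈ : (σ : List ℕ) → IsPerm σ → ∀ {v} → v < length σ → v ∈ σ
IsPerm⇒∈ σ P {v} v<n with v ∈? σ
... | yes v∈ = v∈
... | no  v∉ = ⊥-elim (omitted-value (length σ) refl v<n)
  where
  open IsPerm P
  omitted-value : ∀ n → length σ ≡ n → v < n → ⊥
  omitted-value (suc n) len v< = <⇒notInjective (n<1+n n) squeeze-injective
    where
    at< : (i : Fin (suc n)) → toℕ i < length σ
    at< i = subst (toℕ i <_) (sym len) (toℕ<n i)
    entry< : (i : Fin (suc n)) → at σ (toℕ i) < suc n
    entry< i = subst (at σ (toℕ i) <_) len (All-at σ bounded (at< i))
    v≢entry : (i : Fin (suc n)) → fromℕ< v< ≢ fromℕ< (entry< i)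
    v≢entry i e = v∉ (subst (_∈ σ) (sym (fromℕ<-injective _ _ v< (entry< i) e)) (at-∈ σ (at< i)))
    -- the entries avoid v, so they fit into n values; injectivity fails
    squeeze : Fin (suc n) → Fin n
    squeeze i = punchOut (v≢entry i)
    squeeze-injective : ∀ {i j} → squeeze i ≡ squeeze j → i ≡ j
    squeeze-injective {i} {j} e = toℕ-injective (begin
      toℕ i                             ≡⟨ sym (indexOf-at σ unique (at< i)) ⟩
      indexOf σ (at σ (toℕ i))          ≡⟨ cong (indexOf σ) same-entry ⟩
      indexOf σ (at σ (toℕ j))          ≡⟨ indexOf-at σ unique (at< j) ⟩
      toℕ j                             ∎)
      where
      open ≡-Reasoning
      same-entry = fromℕ<-injective _ _ (entry< i) (entry< j) (punchOut-injective (v≢entry i) (v≢entry j) e)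

inverse : List ℕ → List ℕ
inverse σ = applyUpTo (indexOf σ) (length σ)

-- Exchanging the second and fourth conjuncts (quadrants II and IV).
∧-reorder : ∀ x y z w → x ∧ y ∧ z ∧ w ≡ x ∧ w ∧ z ∧ y
∧-reorder false _     _ _     = refl
∧-reorder true  true  _ true  = refl
∧-reorder true  false _ false = refl
∧-reorder true  true  z false = ∧-zeroʳ z
∧-reorder true  false z true  = sym (∧-zeroʳ z)

module Inverse (σ : List ℕ) (P : IsPerm σ) where
  open IsPerm P

  n = length σ
  τ = inverse σ

  length-τ : length τ ≡ n
  length-τ = length-applyUpTo (indexOf σ) n

  τ-at : ∀ {v} → v < n → at τ v ≡ indexOf σ v
  τ-at = at-applyUpTo (indexOf σ) n

  σ< : ∀ {i} → i < n → at σ i < n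
  σ< = All-at σ bounded

  τ< : ∀ {v} → v < n → at τ v < n
  τ< v< rewrite τ-at v< = proj₂ (at-indexOf σ (IsPerm⇒∈ σ P v<))

  σ∘τ : ∀ {v} → v < n → at σ (at τ v) ≡ v
  σ∘τ v< rewrite τ-at v< = proj₁ (at-indexOf σ (IsPerm⇒∈ σ P v<))

  τ∘σ : ∀ {i} → i < n → at τ (at σ i) ≡ i
  τ∘σ i< rewrite τ-at (σ< i<) = indexOf-at σ unique i<

  -- Transposition principle: counting positions j by a condition on (i, j)
  -- and on the values (σᵢ, σⱼ) is counting values w by the same conditions
  -- read in τ at position σᵢ — the diagram reflected in its diagonal.
  transpose : (R S : ℕ → ℕ → Bool) {i : ℕ} → i < n →
    count< (λ j → R i j ∧ S (at σ i) (at σ j)) n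
      ≡ count< (λ w → S (at σ i) w ∧ R (at τ (at σ i)) (at τ w)) (length τ)
  transpose R S {i} i< = begin
    count< (λ j → R i j ∧ S (at σ i) (at σ j)) n
      ≡⟨ sym (count<-reindex _ n (at τ) (at σ) τ< σ< σ∘τ τ∘σ) ⟩
    count< (λ w → R i (at τ w) ∧ S (at σ i) (at σ (at τ w))) n
      ≡⟨ count<-cong n reflect ⟩
    count< (λ w → S (at σ i) w ∧ R (at τ (at σ i)) (at τ w)) n
      ≡⟨ cong (count< _) (sym length-τ) ⟩
    count< (λ w → S (at σ i) w ∧ R (at τ (at σ i)) (at τ w)) (length τ) ∎
    where
    open ≡-Reasoning
    reflect : ∀ {w} → w < n → R i (at τ w) ∧ S (at σ i) (at σ (at τ w)) ≡ S (at σ i) w ∧ R (at τ (at σ i)) (at τ w)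
    reflect {w} w< rewrite σ∘τ w< | τ∘σ i< = ∧-comm (R i (at τ w)) (S (at σ i) w)

  NE-inverse : ∀ {i} → i < n → NE σ i ≡ NE τ (at σ i)
  NE-inverse {i} i< = trans (countB-drop _ σ i)
    (trans (transpose (λ a b → a <ᵇ b) (λ a b → a <ᵇ b) i<) (sym (countB-drop _ τ (at σ i))))

  NW-inverse : ∀ {i} → i < n → NW σ i ≡ SE τ (at σ i)
  NW-inverse {i} i< = trans (countB-take _ σ i)
    (trans (transpose (λ a b → b <ᵇ a) (λ a b → a <ᵇ b) i<) (sym (countB-drop _ τ (at σ i))))

  SW-inverse : ∀ {i} → i < n → SW σ i ≡ SW τ (at σ i)
  SW-inverse {i} i< = trans (countB-take _ σ i)
    (trans (transpose (λ a b → b <ᵇ a) (λ a b → b <ᵇ a) i<) (sym (countB-take _ τ (at σ i))))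

  SE-inverse : ∀ {i} → i < n → SE σ i ≡ NW τ (at σ i)
  SE-inverse {i} i< = trans (countB-drop _ σ i)
    (trans (transpose (λ a b → a <ᵇ b) (λ a b → b <ᵇ a) i<) (sym (countB-take _ τ (at σ i))))

  matches-inverse : (a b c d : Coord) → ∀ {i} → i < n → matches a b c d σ i ≡ matches a d c b τ (at σ i)
  matches-inverse a b c d {i} i< = begin
    sat a (NE σ i) ∧ sat b (NW σ i) ∧ sat c (SW σ i) ∧ sat d (SE σ i)
      ≡⟨ ∧-reorder (sat a (NE σ i)) (sat b (NW σ i)) (sat c (SW σ i)) (sat d (SE σ i)) ⟩
    sat a (NE σ i) ∧ sat d (SE σ i) ∧ sat c (SW σ i) ∧ sat b (NW σ i)
      ≡⟨ cong₂ _∧_ (cong (sat a) (NE-inverse i<)) (cong₂ _∧_ (cong (sat d) (SE-inverse i<))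
           (cong₂ _∧_ (cong (sat c) (SW-inverse i<)) (cong (sat b) (NW-inverse i<)))) ⟩
    sat a (NE τ v) ∧ sat d (NW τ v) ∧ sat c (SW τ v) ∧ sat b (SE τ v) ∎
    where
    open ≡-Reasoning
    v = at σ i

  mmp-inverse : (a b c d : Coord) → mmp a b c d σ ≡ mmp a d c b τ
  mmp-inverse a b c d = begin
    count< (matches a b c d σ) n           ≡⟨ count<-cong n (matches-inverse a b c d) ⟩
    count< (matches a d c b τ ∘ at σ) n    ≡⟨ count<-reindex _ n (at σ) (at τ) σ< τ< τ∘σ σ∘τ ⟩
    count< (matches a d c b τ) n           ≡⟨ cong (count< _) (sym length-τ) ⟩
    count< (matches a d c b τ) (length τ)  ∎
    where open ≡-Reasoning

  inverse-IsPerm : IsPerm τ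
  inverse-IsPerm = record
    { unique  = applyUpTo⁺₁ (indexOf σ) n (λ i<j j<n e → <⇒≢ i<j (same-value i<j j<n e))
    ; bounded = at-All τ (λ {v} v< → subst (at τ v <_) (sym length-τ) (τ< (subst (v <_) length-τ v<)))
    }
    where
    same-value : ∀ {i j} → i < j → j < n → indexOf σ i ≡ indexOf σ j → i ≡ j
    same-value i<j j<n e = trans (sym (proj₁ (at-indexOf σ (IsPerm⇒∈ σ P (<-trans i<j j<n)))))
      (trans (cong (at σ) e) (proj₁ (at-indexOf σ (IsPerm⇒∈ σ P j<n))))

  -- 132⁻¹ = 132: an occurrence at positions i < j < k of τ gives one at
  -- positions τᵢ < τₖ < τⱼ of σ.
  inverse-Avoids132 : Avoids132 σ → Avoids132 τ
  inverse-Avoids132 avoid {i} {j} {k} i<j j<k k<lτ τi<τk τk<τj =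
    avoid τi<τk τk<τj (τ< j<n) (subst₂ _<_ (sym (σ∘τ i<n)) (sym (σ∘τ j<n)) i<j)
                               (subst₂ _<_ (sym (σ∘τ j<n)) (sym (σ∘τ k<n)) j<k)
    where
    k<n = subst (k <_) length-τ k<lτ
    j<n = <-trans j<k k<n
    i<n = <-trans i<j j<n

  inverse-involutive : inverse τ ≡ σ
  inverse-involutive = at-ext (inverse τ) σ (trans (length-applyUpTo (indexOf τ) (length τ)) length-τ) entry
    where
    entry : ∀ {i} → i < length (inverse τ) → at (inverse τ) i ≡ at σ i
    entry {i} i<′ = begin
      at (inverse τ) i            ≡⟨ at-applyUpTo (indexOf τ) (length τ) i<ₗ ⟩
      indexOf τ i                 ≡⟨ cong (indexOf τ) (sym (τ∘σ i<)) ⟩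
      indexOf τ (at τ (at σ i))   ≡⟨ indexOf-at τ (IsPerm.unique inverse-IsPerm) (subst (at σ i <_) (sym length-τ) (σ< i<)) ⟩
      at σ i                      ∎
      where
      open ≡-Reasoning
      i<ₗ = subst (i <_) (length-applyUpTo (indexOf τ) (length τ)) i<′
      i<  = subst (i <_) length-τ i<ₗ

∈-Sn132⁻ : (n : ℕ) {σ : List ℕ} → σ ∈ Sn132 n → length σ ≡ n × IsPerm σ × Avoids132 σ
∈-Sn132⁻ n {σ} σ∈
  with σ∈Sn , avoids ← ∈-filter⁻ (λ σ → contains132 σ ≟ᵇ false) σ∈
  with σ∈words , dist ← ∈-filter⁻ (λ w → distinct w ≟ᵇ true) σ∈Sn
  with len , bounded ← ∈-words⁻ n n σ∈words
  = len , record { unique = distinct⇒Unique σ dist ; bounded = subst (λ m → All (_< m) σ) (sym len) bounded }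
        , contains132-false⇒ σ avoids

∈-Sn132⁺ : (n : ℕ) {σ : List ℕ} → length σ ≡ n → IsPerm σ → Avoids132 σ → σ ∈ Sn132 n
∈-Sn132⁺ n {σ} len P avoid = ∈-filter⁺ (λ σ → contains132 σ ≟ᵇ false)
  (∈-filter⁺ (λ w → distinct w ≟ᵇ true)
    (∈-words⁺ n n len (subst (λ m → All (_< m) σ) len (IsPerm.bounded P)))
    (Unique⇒distinct σ (IsPerm.unique P)))
  (contains132-false⇐ σ avoid)

unique-Sn132 : (n : ℕ) → Unique (Sn132 n)
unique-Sn132 n = filter⁺ (λ σ → contains132 σ ≟ᵇ false) (filter⁺ (λ w → distinct w ≟ᵇ true) (unique-words n n))

inverse-∈-Sn132 : (n : ℕ) {σ : List ℕ} → σ ∈ Sn132 n → inverse σ ∈ Sn132 n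
inverse-∈-Sn132 n {σ} σ∈ with len , P , avoid ← ∈-Sn132⁻ n σ∈ =
  ∈-Sn132⁺ n (trans length-τ len) inverse-IsPerm (inverse-Avoids132 avoid)
  where open Inverse σ P using (length-τ; inverse-IsPerm; inverse-Avoids132)

inverse-involutive-Sn132 : (n : ℕ) {σ : List ℕ} → σ ∈ Sn132 n → inverse (inverse σ) ≡ σ
inverse-involutive-Sn132 n {σ} σ∈ = Inverse.inverse-involutive σ (proj₁ (proj₂ (∈-Sn132⁻ n σ∈)))

lemma1 : (a b c d : Coord) (n : ℕ) →
    (k : ℕ) → Qcoeff n a b c d k ≡ Qcoeff n a d c b k
lemma1 a b c d n k = begin
  countB (λ σ → mmp a b c d σ ≡ᵇ k) (Sn132 n)
    ≡⟨ countB-cong (Sn132 n) (λ σ∈ → cong (_≡ᵇ k) (mmp-via-inverse σ∈)) ⟩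
  countB ((λ σ → mmp a d c b σ ≡ᵇ k) ∘ inverse) (Sn132 n)
    ≡⟨ countB-bijection _ (Sn132 n) (unique-Sn132 n) inverse inverse
         (inverse-∈-Sn132 n) (inverse-∈-Sn132 n) (inverse-involutive-Sn132 n) (inverse-involutive-Sn132 n) ⟩
  countB (λ σ → mmp a d c b σ ≡ᵇ k) (Sn132 n) ∎
  where
  open ≡-Reasoning
  mmp-via-inverse : ∀ {σ} → σ ∈ Sn132 n → mmp a b c d σ ≡ mmp a d c b (inverse σ)
  mmp-via-inverse {σ} σ∈ = Inverse.mmp-inverse σ (proj₁ (proj₂ (∈-Sn132⁻ n σ∈))) a b c d
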